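{- Let $z \in \mathbb{Z}$ with $|z| \geq 2$, and put $a = g = z^{2}-2$ and $m = z^{4}-4z^{2}+8$. Let \[ \psi = \sqrt{\frac{g\sqrt{m}\,(a+\sqrt{m})}{2}}, \qquad \vartheta = \frac{z + z\sqrt{m} + 2\psi}{4} \] (positive real square roots). Then $\vartheta$ is a root of \[ f_{z}(X) = X^{4} - zX^{3} - \frac{3z^{6}-16z^{4}+37z^{2}-32}{8} X^{2} - \frac{2z^{9}-19z^{7}+72z^{5}-135z^{3}+96z}{16} X - \frac{3z^{12}-40z^{10}+214z^{8}-576z^{6}+719z^{4}-64z^{2}-512}{256}. \] -}

module Defs where

open import Level using (Level; _⊔_; suc)
open import Algebra.Bundles using (CommutativeRing)
open import Relation.Binary.Structures using (IsTotalOrder)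
open import Relation.Binary.Core using (Rel)
open import Relation.Nullary using (¬_)
open import Data.Product using (∃)
import Data.Nat as ℕ
open import Data.Integer as ℤ using (ℤ; +_; -[1+_])

-- An ordered field (the real numbers ℝ are an instance).
record OrderedField (c ℓ₁ ℓ₂ : Level) : Set (suc (c ⊔ ℓ₁ ⊔ ℓ₂)) where
  field
    commutativeRing : CommutativeRing c ℓ₁
  open CommutativeRing commutativeRing public
  field
    _≤_         : Rel Carrier ℓ₂
    isTotalOrder : IsTotalOrder _≈_ _≤_
    +-mono-≤    : ∀ {x y} z → x ≤ y → (x + z) ≤ (y + z)
    *-nonneg    : ∀ {x y} → 0# ≤ x → 0# ≤ y → 0# ≤ (x * y)
    0≉1         : ¬ (0# ≈ 1#)
    inverse     : ∀ x → ¬ (x ≈ 0#) → ∃ λ y → (x * y) ≈ 1#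

module _ {c ℓ₁ ℓ₂} (F : OrderedField c ℓ₁ ℓ₂) where
  open OrderedField F

  fromℕ : ℕ.ℕ → Carrier
  fromℕ ℕ.zero    = 0#
  fromℕ (ℕ.suc n) = 1# + fromℕ n

  fromℤ : ℤ → Carrier
  fromℤ (+ n)      = fromℕ n
  fromℤ -[1+ n ]   = - fromℕ (ℕ.suc n)

  pow : Carrier → ℕ.ℕ → Carrier
  pow x ℕ.zero    = 1#
  pow x (ℕ.suc n) = x * pow x n

-- integer coefficients appearing in f_z (numerators)
c₂ c₁ c₀ : ℤ → ℤ
c₂ z = + 3 ℤ.* z ℤ.^ 6 ℤ.- + 16 ℤ.* z ℤ.^ 4 ℤ.+ + 37 ℤ.* z ℤ.^ 2 ℤ.- + 32
c₁ z = + 2 ℤ.* z ℤ.^ 9 ℤ.- + 19 ℤ.* z ℤ.^ 7 ℤ.+ + 72 ℤ.* z ℤ.^ 5 ℤ.- + 135 ℤ.* z ℤ.^ 3 ℤ.+ + 96 ℤ.* z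
c₀ z = + 3 ℤ.* z ℤ.^ 12 ℤ.- + 40 ℤ.* z ℤ.^ 10 ℤ.+ + 214 ℤ.* z ℤ.^ 8 ℤ.- + 576 ℤ.* z ℤ.^ 6
         ℤ.+ + 719 ℤ.* z ℤ.^ 4 ℤ.- + 64 ℤ.* z ℤ.^ 2 ℤ.- + 512

{-# OPTIONS --safe #-}
-- Put t = 4ϑ. The hypotheses say t − z − zs = 2ψ with (2ψ)² = 2as(a + s), so t is a root of
-- q_s(X) = (X − z − zs)² − 2as(a + s). The product q_s(X) q_{−s}(X) involves s only through s²:
-- it is ((X − z)² + (z² − 2a)s²)² − 4s²(z(X − z) + a²)², and substituting s² = m and a = z² − 2
-- turns its value at 4X into 256 f_z(X).
module Submission where

open import Defs
open import Data.Nat using (_≥_)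
open import Data.Integer as ℤ using (ℤ; ∣_∣; +_)
import Data.Nat as ℕ
import Data.Nat.Properties as ℕ
import Data.Integer.Properties as ℤ
import Data.Sign as Sign
open import Data.Fin using (#_)
open import Data.Vec using (Vec; []; _∷_; lookup; map)
open import Data.Vec.Properties using (lookup-map)
open import Data.Vec.Relation.Binary.Pointwise.Inductive as Pointwise using (Pointwise; []; _∷_)
open import Data.Maybe using (Maybe; just; nothing)
open import Relation.Nullary using (yes; no)
open import Relation.Binary.PropositionalEquality as ≡ using (_≡_)
open import Algebra.Solver.Ring.AlmostCommutativeRing
  using (_-Raw-AlmostCommutative⟶_; fromCommutativeRing)
import Algebra.Solver.Ring
import Algebra.Properties.Ring
import Algebra.Properties.Semiring.Mult
import Algebra.Properties.Semiring.Exp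
import Algebra.Properties.CommutativeSemigroup

module FromℤMorphism {c ℓ₁ ℓ₂} (F : OrderedField c ℓ₁ ℓ₂) where
  open OrderedField F
  open Algebra.Properties.Ring ring using (-‿+-comm; -‿involutive; -0#≈0#; -1*x≈-x)
  open Algebra.Properties.Semiring.Mult semiring using (_×_; ×-homo-+; ×1-homo-*)
  open Algebra.Properties.Semiring.Exp semiring using (_^_; ^-congˡ)
  open Algebra.Properties.CommutativeSemigroup +-commutativeSemigroup
    using () renaming (interchange to +-interchange)
  open Algebra.Properties.CommutativeSemigroup *-commutativeSemigroup
    using () renaming (interchange to *-interchange)
  open import Relation.Binary.Reasoning.Setoid setoid

  fromℕ≡×1# : ∀ n → fromℕ F n ≡ n × 1#
  fromℕ≡×1# ℕ.zero    = ≡.refl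
  fromℕ≡×1# (ℕ.suc n) = ≡.cong (_+_ 1#) (fromℕ≡×1# n)

  fromℕ-+ : ∀ m n → fromℕ F (m ℕ.+ n) ≈ fromℕ F m + fromℕ F n
  fromℕ-+ m n rewrite fromℕ≡×1# (m ℕ.+ n) | fromℕ≡×1# m | fromℕ≡×1# n = ×-homo-+ 1# m n

  fromℕ-* : ∀ m n → fromℕ F (m ℕ.* n) ≈ fromℕ F m * fromℕ F n
  fromℕ-* m n rewrite fromℕ≡×1# (m ℕ.* n) | fromℕ≡×1# m | fromℕ≡×1# n = ×1-homo-* m n

  x+y-[x+z]≈y-z : ∀ x y z → (x + y) - (x + z) ≈ y - z
  x+y-[x+z]≈y-z x y z = begin
    (x + y) + - (x + z)   ≈⟨ +-congˡ (-‿+-comm x z) ⟨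
    (x + y) + (- x + - z) ≈⟨ +-interchange x y (- x) (- z) ⟩
    (x - x) + (y - z)     ≈⟨ +-congʳ (-‿inverseʳ x) ⟩
    0# + (y - z)          ≈⟨ +-identityˡ (y - z) ⟩
    y - z                 ∎

  fromℤ-⊖ : ∀ m n → fromℤ F (m ℤ.⊖ n) ≈ fromℕ F m - fromℕ F n
  fromℤ-⊖ ℕ.zero    ℕ.zero    = sym (-‿inverseʳ 0#)
  fromℤ-⊖ (ℕ.suc m) ℕ.zero    = sym (trans (+-congˡ -0#≈0#) (+-identityʳ _))
  fromℤ-⊖ ℕ.zero    (ℕ.suc n) = sym (+-identityˡ _)
  fromℤ-⊖ (ℕ.suc m) (ℕ.suc n) = begin
    fromℤ F (ℕ.suc m ℤ.⊖ ℕ.suc n)   ≡⟨ ≡.cong (fromℤ F) (ℤ.[1+m]⊖[1+n]≡m⊖n m n) ⟩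
    fromℤ F (m ℤ.⊖ n)               ≈⟨ fromℤ-⊖ m n ⟩
    fromℕ F m - fromℕ F n           ≈⟨ x+y-[x+z]≈y-z 1# _ _ ⟨
    fromℕ F (ℕ.suc m) - fromℕ F (ℕ.suc n) ∎

  fromℤ-‿ : ∀ i → fromℤ F (ℤ.- i) ≈ - fromℤ F i
  fromℤ-‿ ℤ.-[1+ n ]     = sym (-‿involutive _)
  fromℤ-‿ (+ ℕ.zero)    = sym -0#≈0#
  fromℤ-‿ (+ ℕ.suc n)   = refl

  fromℤ-+ : ∀ i j → fromℤ F (i ℤ.+ j) ≈ fromℤ F i + fromℤ F j
  fromℤ-+ ℤ.-[1+ m ] ℤ.-[1+ n ] = begin
    - fromℕ F (ℕ.suc (ℕ.suc (m ℕ.+ n)))       ≡⟨ ≡.cong (λ k → - fromℕ F (ℕ.suc k)) (ℕ.+-suc m n) ⟨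
    - fromℕ F (ℕ.suc m ℕ.+ ℕ.suc n)           ≈⟨ -‿cong (fromℕ-+ (ℕ.suc m) (ℕ.suc n)) ⟩
    - (fromℕ F (ℕ.suc m) + fromℕ F (ℕ.suc n)) ≈⟨ -‿+-comm _ _ ⟨
    - fromℕ F (ℕ.suc m) + - fromℕ F (ℕ.suc n) ∎
  fromℤ-+ ℤ.-[1+ m ] (+ n)      = trans (fromℤ-⊖ n (ℕ.suc m)) (+-comm _ _)
  fromℤ-+ (+ m)      ℤ.-[1+ n ] = fromℤ-⊖ m (ℕ.suc n)
  fromℤ-+ (+ m)      (+ n)      = fromℕ-+ m n

  fromSign : Sign.Sign → Carrier
  fromSign Sign.+ = 1#
  fromSign Sign.- = - 1#

  fromSign-* : ∀ s t → fromSign (s Sign.* t) ≈ fromSign s * fromSign t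
  fromSign-* Sign.+ t      = sym (*-identityˡ _)
  fromSign-* Sign.- Sign.+ = sym (*-identityʳ _)
  fromSign-* Sign.- Sign.- = sym (trans (-1*x≈-x (- 1#)) (-‿involutive 1#))

  fromℤ-◃ : ∀ s n → fromℤ F (s ℤ.◃ n) ≈ fromSign s * fromℕ F n
  fromℤ-◃ s      ℕ.zero    = sym (zeroʳ _)
  fromℤ-◃ Sign.+ (ℕ.suc n) = sym (*-identityˡ _)
  fromℤ-◃ Sign.- (ℕ.suc n) = sym (-1*x≈-x _)

  fromℤ≈sign*abs : ∀ i → fromℤ F i ≈ fromSign (ℤ.sign i) * fromℕ F ∣ i ∣
  fromℤ≈sign*abs i = begin
    fromℤ F i                            ≡⟨ ≡.cong (fromℤ F) (ℤ.◃-inverse i) ⟨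
    fromℤ F (ℤ.sign i ℤ.◃ ∣ i ∣)         ≈⟨ fromℤ-◃ (ℤ.sign i) ∣ i ∣ ⟩
    fromSign (ℤ.sign i) * fromℕ F ∣ i ∣  ∎

  fromℤ-* : ∀ i j → fromℤ F (i ℤ.* j) ≈ fromℤ F i * fromℤ F j
  fromℤ-* i j = begin
    fromℤ F (ℤ.sign i Sign.* ℤ.sign j ℤ.◃ ∣ i ∣ ℕ.* ∣ j ∣)
      ≈⟨ fromℤ-◃ (ℤ.sign i Sign.* ℤ.sign j) (∣ i ∣ ℕ.* ∣ j ∣) ⟩
    fromSign (ℤ.sign i Sign.* ℤ.sign j) * fromℕ F (∣ i ∣ ℕ.* ∣ j ∣)
      ≈⟨ *-cong (fromSign-* (ℤ.sign i) (ℤ.sign j)) (fromℕ-* ∣ i ∣ ∣ j ∣) ⟩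
    (fromSign (ℤ.sign i) * fromSign (ℤ.sign j)) * (fromℕ F ∣ i ∣ * fromℕ F ∣ j ∣)
      ≈⟨ *-interchange _ _ _ _ ⟩
    (fromSign (ℤ.sign i) * fromℕ F ∣ i ∣) * (fromSign (ℤ.sign j) * fromℕ F ∣ j ∣)
      ≈⟨ *-cong (fromℤ≈sign*abs i) (fromℤ≈sign*abs j) ⟨
    fromℤ F i * fromℤ F j ∎

  fromℤ-morphism : ℤ.+-*-rawRing -Raw-AlmostCommutative⟶ fromCommutativeRing commutativeRing
  fromℤ-morphism = record
    { ⟦_⟧    = fromℤ F
    ; +-homo = fromℤ-+
    ; *-homo = fromℤ-*
    ; -‿homo = fromℤ-‿
    ; 0-homo = refl
    ; 1-homo = +-identityʳ 1#
    }

  fromℤ-≟ : ∀ i j → Maybe (fromℤ F i ≈ fromℤ F j)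
  fromℤ-≟ i j with i ℤ.≟ j
  ... | yes ≡.refl = just refl
  ... | no _       = nothing

  open Algebra.Solver.Ring ℤ.+-*-rawRing (fromCommutativeRing commutativeRing)
    fromℤ-morphism fromℤ-≟ public

  evalℤ : ∀ {n} → Polynomial n → Vec ℤ n → ℤ
  evalℤ (op [+] p q) ρ = evalℤ p ρ ℤ.+ evalℤ q ρ
  evalℤ (op [*] p q) ρ = evalℤ p ρ ℤ.* evalℤ q ρ
  evalℤ (con i)      ρ = i
  evalℤ (var x)      ρ = lookup ρ x
  evalℤ (p :^ n)     ρ = evalℤ p ρ ℤ.^ n
  evalℤ (:- p)       ρ = ℤ.- evalℤ p ρ

  fromℤ-^ : ∀ i n → fromℤ F (i ℤ.^ n) ≈ fromℤ F i ^ n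
  fromℤ-^ i ℕ.zero    = +-identityʳ 1#
  fromℤ-^ i (ℕ.suc n) = trans (fromℤ-* i (i ℤ.^ n)) (*-congˡ (fromℤ-^ i n))

  fromℤ-evalℤ : ∀ {n} (p : Polynomial n) ρ → fromℤ F (evalℤ p ρ) ≈ ⟦ p ⟧ (map (fromℤ F) ρ)
  fromℤ-evalℤ (op [+] p q) ρ =
    trans (fromℤ-+ (evalℤ p ρ) (evalℤ q ρ)) (+-cong (fromℤ-evalℤ p ρ) (fromℤ-evalℤ q ρ))
  fromℤ-evalℤ (op [*] p q) ρ =
    trans (fromℤ-* (evalℤ p ρ) (evalℤ q ρ)) (*-cong (fromℤ-evalℤ p ρ) (fromℤ-evalℤ q ρ))
  fromℤ-evalℤ (con i)      ρ = refl
  fromℤ-evalℤ (var x)      ρ = reflexive (≡.sym (lookup-map x (fromℤ F) ρ))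
  fromℤ-evalℤ (p :^ n)     ρ = trans (fromℤ-^ (evalℤ p ρ) n) (^-congˡ n (fromℤ-evalℤ p ρ))
  fromℤ-evalℤ (:- p)       ρ = trans (fromℤ-‿ (evalℤ p ρ)) (-‿cong (fromℤ-evalℤ p ρ))

  ⟦⟧-cong : ∀ {n} (p : Polynomial n) {ρ ρ′} → Pointwise _≈_ ρ ρ′ → ⟦ p ⟧ ρ ≈ ⟦ p ⟧ ρ′
  ⟦⟧-cong (op [+] p q) ρ≈ρ′ = +-cong (⟦⟧-cong p ρ≈ρ′) (⟦⟧-cong q ρ≈ρ′)
  ⟦⟧-cong (op [*] p q) ρ≈ρ′ = *-cong (⟦⟧-cong p ρ≈ρ′) (⟦⟧-cong q ρ≈ρ′)
  ⟦⟧-cong (con i)      ρ≈ρ′ = refl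
  ⟦⟧-cong (var x)      ρ≈ρ′ = Pointwise.lookup ρ≈ρ′ x
  ⟦⟧-cong (p :^ n)     ρ≈ρ′ = ^-congˡ n (⟦⟧-cong p ρ≈ρ′)
  ⟦⟧-cong (:- p)       ρ≈ρ′ = -‿cong (⟦⟧-cong p ρ≈ρ′)

module RootOfQuartic {c ℓ₁ ℓ₂} (F : OrderedField c ℓ₁ ℓ₂) where
  open OrderedField F
  open FromℤMorphism F
  open Algebra.Properties.Semiring.Exp semiring using (_^_; ^-congˡ)
  open import Relation.Binary.Reasoning.Setoid setoid

  -- pᴾ is ring-solver syntax whose denotation is definitionally p; for the coefficients of Defs,
  -- evalℤ (c₂ᴾ (var (# 0))) (z ∷ []) likewise reduces to c₂ z.
  quadraticᴾ : ∀ {n} (t z a s : Polynomial n) → Polynomial n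
  quadraticᴾ t z a s = (t :- z :- z :* s) :^ 2 :- con (+ 2) :* (a :* s :* (a :+ s))

  quadraticNormᴾ : ∀ {n} (t z a S : Polynomial n) → Polynomial n
  quadraticNormᴾ t z a S =
    ((t :- z) :^ 2 :+ (z :^ 2 :- con (+ 2) :* a) :* S) :^ 2
      :- con (+ 4) :* S :* (z :* (t :- z) :+ a :^ 2) :^ 2

  quadratic : (t z a s : Carrier) → Carrier
  quadratic t z a s = (t - z - z * s) ^ 2 - fromℤ F (+ 2) * (a * s * (a + s))

  quadraticNorm : (t z a S : Carrier) → Carrier
  quadraticNorm t z a S =
    ((t - z) ^ 2 + (z ^ 2 - fromℤ F (+ 2) * a) * S) ^ 2
      - fromℤ F (+ 4) * S * (z * (t - z) + a ^ 2) ^ 2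

  quadratic-root : ∀ {t z a s ψ} →
    fromℤ F (+ 2) * (ψ * ψ) ≈ a * s * (a + s) →
    t ≈ z + z * s + fromℤ F (+ 2) * ψ →
    quadratic t z a s ≈ 0#
  quadratic-root {t} {z} {a} {s} {ψ} 2ψ²≈as[a+s] t≈z+zs+2ψ = begin
    quadratic t z a s
      ≈⟨ +-cong (^-congˡ 2 (+-congʳ (+-congʳ t≈z+zs+2ψ))) (-‿cong (*-congˡ (sym 2ψ²≈as[a+s]))) ⟩
    (z + z * s + fromℤ F (+ 2) * ψ - z - z * s) ^ 2 - fromℤ F (+ 2) * (fromℤ F (+ 2) * (ψ * ψ))
      ≈⟨ solve 3 (λ z s ψ →
           (z :+ z :* s :+ con (+ 2) :* ψ :- z :- z :* s) :^ 2 :- con (+ 2) :* (con (+ 2) :* (ψ :* ψ))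
             := con (+ 0)) refl z s ψ ⟩
    0# ∎

  quadratic*conjugate≈quadraticNorm : ∀ t z a s →
    quadratic t z a s * quadratic t z a (- s) ≈ quadraticNorm t z a (s * s)
  quadratic*conjugate≈quadraticNorm = solve 4 (λ t z a s →
    quadraticᴾ t z a s :* quadraticᴾ t z a (:- s) := quadraticNormᴾ t z a (s :* s)) refl

  aᴾ mᴾ c₂ᴾ c₁ᴾ c₀ᴾ : ∀ {n} → Polynomial n → Polynomial n
  aᴾ z  = z :^ 2 :- con (+ 2)
  mᴾ z  = z :^ 4 :- con (+ 4) :* z :^ 2 :+ con (+ 8)
  c₂ᴾ z = con (+ 3) :* z :^ 6 :- con (+ 16) :* z :^ 4 :+ con (+ 37) :* z :^ 2 :- con (+ 32)
  c₁ᴾ z = con (+ 2) :* z :^ 9 :- con (+ 19) :* z :^ 7 :+ con (+ 72) :* z :^ 5 :- con (+ 135) :* z :^ 3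
          :+ con (+ 96) :* z
  c₀ᴾ z = con (+ 3) :* z :^ 12 :- con (+ 40) :* z :^ 10 :+ con (+ 214) :* z :^ 8 :- con (+ 576) :* z :^ 6
          :+ con (+ 719) :* z :^ 4 :- con (+ 64) :* z :^ 2 :- con (+ 512)

  quarticᴾ : ∀ {n} (z c₂ c₁ c₀ x : Polynomial n) → Polynomial n
  quarticᴾ z c₂ c₁ c₀ x =
    con (+ 256) :* x :^ 4 :- con (+ 256) :* z :* x :^ 3 :- con (+ 32) :* c₂ :* x :^ 2
      :- con (+ 16) :* c₁ :* x :- c₀

  quadraticNorm-cong : ∀ {t z a a′ S S′} → a ≈ a′ → S ≈ S′ →
                       quadraticNorm t z a S ≈ quadraticNorm t z a′ S′
  quadraticNorm-cong a≈a′ S≈S′ =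
    ⟦⟧-cong (quadraticNormᴾ (var (# 0)) (var (# 1)) (var (# 2)) (var (# 3)))
      (refl ∷ refl ∷ a≈a′ ∷ S≈S′ ∷ [])

  quartic≈quadraticNorm : ∀ z x →
    fromℤ F (+ 256) * x ^ 4
      - fromℤ F (+ 256) * fromℤ F z * x ^ 3
      - fromℤ F (+ 32) * fromℤ F (c₂ z) * x ^ 2
      - fromℤ F (+ 16) * fromℤ F (c₁ z) * x
      - fromℤ F (c₀ z)
    ≈ quadraticNorm (fromℤ F (+ 4) * x) (fromℤ F z)
        (fromℤ F (z ℤ.^ 2 ℤ.- + 2)) (fromℤ F (z ℤ.^ 4 ℤ.- + 4 ℤ.* z ℤ.^ 2 ℤ.+ + 8))
  quartic≈quadraticNorm z x = begin
    _ ≈⟨ ⟦⟧-cong (quarticᴾ (var (# 0)) (var (# 1)) (var (# 2)) (var (# 3)) (var (# 4)))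
           (refl ∷ image c₂ᴾ ∷ image c₁ᴾ ∷ image c₀ᴾ ∷ refl ∷ []) ⟩
    _ ≈⟨ solve 2 (λ z x → quarticᴾ z (c₂ᴾ z) (c₁ᴾ z) (c₀ᴾ z) x
                          := quadraticNormᴾ (con (+ 4) :* x) z (aᴾ z) (mᴾ z)) refl (fromℤ F z) x ⟩
    _ ≈⟨ quadraticNorm-cong (image aᴾ) (image mᴾ) ⟨
    _ ∎
    where
    image : (p : Polynomial 1 → Polynomial 1) →
            fromℤ F (evalℤ (p (var (# 0))) (z ∷ [])) ≈ ⟦ p (var (# 0)) ⟧ (fromℤ F z ∷ [])
    image p = fromℤ-evalℤ (p (var (# 0))) (z ∷ [])

lemma2p4 : ∀ {c ℓ₁ ℓ₂} (F : OrderedField c ℓ₁ ℓ₂) → let open OrderedField F in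
  (z : ℤ) → ∣ z ∣ ≥ 2 →
  let a = z ℤ.^ 2 ℤ.- + 2
      g = z ℤ.^ 2 ℤ.- + 2
      m = z ℤ.^ 4 ℤ.- + 4 ℤ.* z ℤ.^ 2 ℤ.+ + 8
  in (s ψ ϑ : Carrier) →
  0# ≤ s → s * s ≈ fromℤ F m →
  0# ≤ ψ → fromℤ F (+ 2) * (ψ * ψ) ≈ fromℤ F g * s * (fromℤ F a + s) →
  fromℤ F (+ 4) * ϑ ≈ fromℤ F z + fromℤ F z * s + fromℤ F (+ 2) * ψ →
  fromℤ F (+ 256) * pow F ϑ 4
    - fromℤ F (+ 256) * fromℤ F z * pow F ϑ 3
    - fromℤ F (+ 32) * fromℤ F (c₂ z) * pow F ϑ 2
    - fromℤ F (+ 16) * fromℤ F (c₁ z) * ϑ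
    - fromℤ F (c₀ z) ≈ 0#
lemma2p4 F z _ s ψ ϑ _ s²≈m _ 2ψ²≈as[a+s] 4ϑ≈z+zs+2ψ = begin
  _                                      ≈⟨ quartic≈quadraticNorm z ϑ ⟩
  quadraticNorm T Z A _                  ≈⟨ quadraticNorm-cong refl (sym s²≈m) ⟩
  quadraticNorm T Z A (s * s)            ≈⟨ quadratic*conjugate≈quadraticNorm T Z A s ⟨
  quadratic T Z A s * quadratic T Z A (- s)
                                         ≈⟨ *-congʳ (quadratic-root 2ψ²≈as[a+s] 4ϑ≈z+zs+2ψ) ⟩
  0# * quadratic T Z A (- s)             ≈⟨ zeroˡ _ ⟩
  0#                                     ∎
  where
  open OrderedField F
  open RootOfQuartic F
  open import Relation.Binary.Reasoning.Setoid setoid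
  T Z A : Carrier
  T = fromℤ F (+ 4) * ϑ
  Z = fromℤ F z
  A = fromℤ F (z ℤ.^ 2 ℤ.- + 2)
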